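{- Let $D=(E,\mathcal{F})$ be a delta-matroid. Then the twist polynomial ${}^{\partial}w_{D}(z)$ is a constant $k$ (for some integer $k$) if and only if $|\mathcal{F}|=1$.
   Context: A delta-matroid is a pair $D=(E,\mathcal{F})$, $E$ finite, $\mathcal{F}$ a nonempty family of subsets of $E$ such that for all $X,Y\in\mathcal{F}$ and $u\in X\Delta Y$ there is $v\in X\Delta Y$ (possibly $v=u$) with $X\Delta\{u,v\}\in\mathcal{F}$. Twist: $D*A=(E,\{A\Delta X: X\in\mathcal{F}\})$; width $w(D)$: maximum minus minimum cardinality of a feasible set; twist polynomial ${}^{\partial}w_{D}(z)=\sum_{A\subseteq E} z^{w(D*A)}$. -}

module Defs where

open import Data.Nat using (ℕ; zero; suc; _∸_; _⊔_; _⊓_)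
open import Data.Bool using (Bool; true; false; _xor_)
open import Data.Fin using (Fin)
open import Data.Fin.Subset using (Subset; _∈_; ⁅_⁆; _∪_; ∣_∣)
open import Data.Vec using (Vec; []; _∷_; zipWith)
open import Data.List using (List; []; _∷_; map; filter; foldr; length; _++_)
open import Data.Product using (Σ; ∃; _×_; _,_)
open import Relation.Binary.PropositionalEquality using (_≡_)
open import Relation.Nullary.Decidable using (does)
open import Data.Nat using (_≟_)
open import Data.Bool using (_≟_)

-- The ground set E is Fin n.  A family of subsets of E is represented by its
-- (Boolean) indicator on subsets: F X ≡ true  iff  X is a member of the family.
Family : ℕ → Set
Family n = Subset n → Bool

_Δ_ : ∀ {n} → Subset n → Subset n → Subset n
X Δ Y = zipWith _xor_ X Y

allSubsets : ∀ n → List (Subset n)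
allSubsets zero = [] ∷ []
allSubsets (suc n) = map (true ∷_) (allSubsets n) ++ map (false ∷_) (allSubsets n)

members : ∀ {n} → Family n → List (Subset n)
members {n} F = filter (λ X → F X Data.Bool.≟ true) (allSubsets n)

card : ∀ {n} → Family n → ℕ
card F = length (members F)

record IsDeltaMatroid {n : ℕ} (F : Family n) : Set where
  field
    nonempty : ∃ λ X → F X ≡ true
    exchange : ∀ X Y → F X ≡ true → F Y ≡ true →
               ∀ u → u ∈ (X Δ Y) →
               ∃ λ v → v ∈ (X Δ Y) × F (X Δ (⁅ u ⁆ ∪ ⁅ v ⁆)) ≡ true

twist : ∀ {n} → Family n → Subset n → Family n
twist F A Y = F (A Δ Y)

-- Width: maximum minus minimum cardinality of a feasible set.
-- (For a nonempty family; the initial values n and 0 are bounds for sizes.)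
maxSize : ∀ {n} → Family n → ℕ
maxSize F = foldr (λ X m → ∣ X ∣ ⊔ m) 0 (members F)

minSize : ∀ {n} → Family n → ℕ
minSize {n} F = foldr (λ X m → ∣ X ∣ ⊓ m) n (members F)

width : ∀ {n} → Family n → ℕ
width F = maxSize F ∸ minSize F

-- Twist polynomial  ∂w_D(z) = Σ_{A ⊆ E} z^{w(D*A)},  represented by its
-- coefficient function: coefficient of z^j = #{A ⊆ E : w(D*A) = j}.
twistPoly : ∀ {n} → Family n → ℕ → ℕ
twistPoly {n} F j =
  length (filter (λ A → width (twist F A) Data.Nat.≟ j) (allSubsets n))

constPoly : ℕ → ℕ → ℕ
constPoly k zero = k
constPoly k (suc j) = 0

-- Twisting by a feasible set X sends X to ∅ and every feasible Y to X Δ Y, so the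
-- width of D * X is at least |X Δ Y|.  Hence all twists have width 0 (equivalently,
-- the twist polynomial is the constant 2^|E|) exactly when there is a single
-- feasible set.
module Submission where

open import Defs
open import Data.Nat using (ℕ; zero; suc; _≤_; _⊔_; _⊓_; z≤n; _≟_)
open import Data.Nat.Properties
  using (≤-reflexive; ≤-trans; m≤m⊔n; m≤n⇒m≤o⊔n; m⊓n≤m; m≤n⇒o⊓m≤n; ⊔-lub; ⊓-glb;
         ∸-mono; m≤n⇒m∸n≡0; n≤0⇒n≡0; 0≢1+n; <⇒≢)
open import Data.Bool using (true; false)
import Data.Bool as Bool
open import Data.Vec using ([]; _∷_)
import Data.Vec.Properties as Vec
open import Data.List using (List; []; _∷_; map; filter; foldr; length)
open import Data.List.Properties using (filter-all; filter-none; filter-some)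
open import Data.List.Relation.Unary.All using ([]; _∷_; tabulate)
open import Data.List.Relation.Unary.Any using (here; there)
open import Data.List.Relation.Unary.Unique.Propositional using (Unique; []; _∷_)
import Data.List.Relation.Unary.Unique.Propositional.Properties as Unique
open import Data.List.Membership.Propositional using (lose) renaming (_∈_ to _∈ₗ_)
open import Data.List.Membership.Propositional.Properties
  using (∈-map⁺; ∈-map⁻; ∈-++⁺ˡ; ∈-++⁺ʳ; ∈-filter⁺; ∈-filter⁻)
open import Data.Fin.Subset using (Subset; ∣_∣; ⊥)
open import Data.Fin.Subset.Properties using (∣p∣≤n; ∣⊥∣≡0)
open import Data.Product using (∃; _×_; _,_; proj₂)
open import Function using (_∘_)
open import Function.Bundles using (_⇔_; mk⇔; Equivalence)
import Function.Properties.Equivalence as ⇔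
open import Relation.Nullary using (¬_; Dec; contradiction)
open import Relation.Binary.PropositionalEquality

private
  variable
    n : ℕ

Δ-cancelˡ : (X Y : Subset n) → X Δ (X Δ Y) ≡ Y
Δ-cancelˡ []          []          = refl
Δ-cancelˡ (true ∷ X)  (true ∷ Y)  = cong (true ∷_) (Δ-cancelˡ X Y)
Δ-cancelˡ (true ∷ X)  (false ∷ Y) = cong (false ∷_) (Δ-cancelˡ X Y)
Δ-cancelˡ (false ∷ X) (b ∷ Y)     = cong (b ∷_) (Δ-cancelˡ X Y)

Δ-self : (X : Subset n) → X Δ X ≡ ⊥
Δ-self []          = refl
Δ-self (true ∷ X)  = cong (false ∷_) (Δ-self X)
Δ-self (false ∷ X) = cong (false ∷_) (Δ-self X)

∣Δ∣≡0⇒≡ : (X Y : Subset n) → ∣ X Δ Y ∣ ≡ 0 → X ≡ Y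
∣Δ∣≡0⇒≡ []          []          _  = refl
∣Δ∣≡0⇒≡ (true ∷ X)  (true ∷ Y)  eq = cong (true ∷_) (∣Δ∣≡0⇒≡ X Y eq)
∣Δ∣≡0⇒≡ (false ∷ X) (false ∷ Y) eq = cong (false ∷_) (∣Δ∣≡0⇒≡ X Y eq)
∣Δ∣≡0⇒≡ (true ∷ X)  (false ∷ Y) ()
∣Δ∣≡0⇒≡ (false ∷ X) (true ∷ Y)  ()

∈-allSubsets : (X : Subset n) → X ∈ₗ allSubsets n
∈-allSubsets []                = here refl
∈-allSubsets {suc n} (true ∷ X)  = ∈-++⁺ˡ (∈-map⁺ (true ∷_) (∈-allSubsets X))
∈-allSubsets {suc n} (false ∷ X) =
  ∈-++⁺ʳ (map (true ∷_) (allSubsets n)) (∈-map⁺ (false ∷_) (∈-allSubsets X))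

allSubsets-unique : ∀ n → Unique (allSubsets n)
allSubsets-unique zero    = [] ∷ []
allSubsets-unique (suc n) =
  Unique.++⁺ (Unique.map⁺ Vec.∷-injectiveʳ (allSubsets-unique n))
             (Unique.map⁺ Vec.∷-injectiveʳ (allSubsets-unique n))
             heads-differ
  where
  heads-differ : ∀ {X} → ¬ (X ∈ₗ map (true ∷_) (allSubsets n) ×
                           X ∈ₗ map (false ∷_) (allSubsets n))
  heads-differ (X∈ₜ , X∈f) with ∈-map⁻ (true ∷_) X∈ₜ | ∈-map⁻ (false ∷_) X∈f
  ... | _ , _ , refl | _ , _ , ()

module _ (F : Family n) where

  feasible? : ∀ X → Dec (F X ≡ true)
  feasible? X = F X Bool.≟ true

  ∈-members⁺ : ∀ {X} → F X ≡ true → X ∈ₗ members F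
  ∈-members⁺ {X} = ∈-filter⁺ feasible? (∈-allSubsets X)

  ∈-members⁻ : ∀ {X} → X ∈ₗ members F → F X ≡ true
  ∈-members⁻ X∈ = proj₂ (∈-filter⁻ feasible? {xs = allSubsets n} X∈)

  members-unique : Unique (members F)
  members-unique = Unique.filter⁺ feasible? (allSubsets-unique n)

length≡1⇒singleton : ∀ {A : Set} {xs : List A} → length xs ≡ 1 →
                     ∃ λ x → x ∈ₗ xs × (∀ {y} → y ∈ₗ xs → y ≡ x)
length≡1⇒singleton {xs = x ∷ []} _ = x , here refl , λ { (here y≡x) → y≡x }

unique-singleton⇒length≡1 : ∀ {A : Set} {xs : List A} {x} → Unique xs → x ∈ₗ xs →
                            (∀ {y} → y ∈ₗ xs → y ≡ x) → length xs ≡ 1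
unique-singleton⇒length≡1 {xs = _ ∷ []}     _                 _ _    = refl
unique-singleton⇒length≡1 {xs = _ ∷ _ ∷ _} ((y≢z ∷ _) ∷ _) _ only =
  contradiction (trans (only (here refl)) (sym (only (there (here refl))))) y≢z

module _ {A : Set} (f : A → ℕ) (b : ℕ) where

  ≤-foldr-⊔ : ∀ {x xs} → x ∈ₗ xs → f x ≤ foldr (λ y m → f y ⊔ m) b xs
  ≤-foldr-⊔ {xs = y ∷ _}  (here refl) = m≤m⊔n (f y) _
  ≤-foldr-⊔ {xs = y ∷ _}  (there x∈)  = m≤n⇒m≤o⊔n (f y) (≤-foldr-⊔ x∈)

  foldr-⊔-lub : ∀ {m} xs → b ≤ m → (∀ {x} → x ∈ₗ xs → f x ≤ m) →
                foldr (λ y m → f y ⊔ m) b xs ≤ m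
  foldr-⊔-lub []       b≤m _     = b≤m
  foldr-⊔-lub (x ∷ xs) b≤m bound = ⊔-lub (bound (here refl)) (foldr-⊔-lub xs b≤m (bound ∘ there))

  foldr-⊓-≤ : ∀ {x xs} → x ∈ₗ xs → foldr (λ y m → f y ⊓ m) b xs ≤ f x
  foldr-⊓-≤ {xs = y ∷ _}  (here refl) = m⊓n≤m (f y) _
  foldr-⊓-≤ {xs = y ∷ _}  (there x∈)  = m≤n⇒o⊓m≤n (f y) (foldr-⊓-≤ x∈)

  foldr-⊓-glb : ∀ {m} xs → m ≤ b → (∀ {x} → x ∈ₗ xs → m ≤ f x) →
                m ≤ foldr (λ y m → f y ⊓ m) b xs
  foldr-⊓-glb []       m≤b _     = m≤b
  foldr-⊓-glb (x ∷ xs) m≤b bound = ⊓-glb (bound (here refl)) (foldr-⊓-glb xs m≤b (bound ∘ there))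

IsSingleton : Family n → Subset n → Set
IsSingleton F X₀ = F X₀ ≡ true × (∀ {Y} → F Y ≡ true → Y ≡ X₀)

card≡1⇔singleton : (F : Family n) → card F ≡ 1 ⇔ ∃ (IsSingleton F)
card≡1⇔singleton F = mk⇔ to from
  where
  to : card F ≡ 1 → ∃ (IsSingleton F)
  to card≡1 with length≡1⇒singleton card≡1
  ... | X₀ , X₀∈ , only = X₀ , ∈-members⁻ F X₀∈ , only ∘ ∈-members⁺ F
  from : ∃ (IsSingleton F) → card F ≡ 1
  from (X₀ , FX₀ , only) =
    unique-singleton⇒length≡1 (members-unique F) (∈-members⁺ F FX₀) (only ∘ ∈-members⁻ F)

width-singleton : (F : Family n) {X₀ : Subset n} → IsSingleton F X₀ → width F ≡ 0
width-singleton F {X₀} (_ , only) = m≤n⇒m∸n≡0 (≤-trans max≤∣X₀∣ ∣X₀∣≤min)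
  where
  max≤∣X₀∣ : maxSize F ≤ ∣ X₀ ∣
  max≤∣X₀∣ = foldr-⊔-lub ∣_∣ 0 (members F) z≤n (≤-reflexive ∘ cong ∣_∣ ∘ only ∘ ∈-members⁻ F)
  ∣X₀∣≤min : ∣ X₀ ∣ ≤ minSize F
  ∣X₀∣≤min = foldr-⊓-glb ∣_∣ _ (members F) (∣p∣≤n X₀)
               (≤-reflexive ∘ cong ∣_∣ ∘ sym ∘ only ∘ ∈-members⁻ F)

twist-singleton : (F : Family n) {X₀ : Subset n} (A : Subset n) →
                  IsSingleton F X₀ → IsSingleton (twist F A) (A Δ X₀)
twist-singleton F {X₀} A (FX₀ , only) =
    subst (λ X → F X ≡ true) (sym (Δ-cancelˡ A X₀)) FX₀
  , λ {Y} FAΔY → trans (sym (Δ-cancelˡ A Y)) (cong (A Δ_) (only FAΔY))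

∣Δ∣≤width-twist : (F : Family n) {X Y : Subset n} → F X ≡ true → F Y ≡ true →
                  ∣ X Δ Y ∣ ≤ width (twist F X)
∣Δ∣≤width-twist {n} F {X} {Y} FX FY = ∸-mono ∣XΔY∣≤max min≤0
  where
  T = twist F X
  feasibleᵀ : ∀ {Z} → F Z ≡ true → T (X Δ Z) ≡ true
  feasibleᵀ {Z} FZ = subst (λ W → F W ≡ true) (sym (Δ-cancelˡ X Z)) FZ
  ∣XΔY∣≤max : ∣ X Δ Y ∣ ≤ maxSize T
  ∣XΔY∣≤max = ≤-foldr-⊔ ∣_∣ 0 (∈-members⁺ T (feasibleᵀ FY))
  min≤0 : minSize T ≤ 0
  min≤0 = ≤-trans (foldr-⊓-≤ ∣_∣ _ (∈-members⁺ T (feasibleᵀ FX)))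
                  (≤-reflexive (trans (cong ∣_∣ (Δ-self X)) (∣⊥∣≡0 n)))

constant-twistPoly⇔twists-narrow : (F : Family n) →
  (∃ λ k → ∀ j → twistPoly F j ≡ constPoly k j) ⇔ (∀ A → width (twist F A) ≡ 0)
constant-twistPoly⇔twists-narrow {n} F = mk⇔ to from
  where
  widthOf? : ∀ j A → Dec (width (twist F A) ≡ j)
  widthOf? j A = width (twist F A) ≟ j
  to : (∃ λ k → ∀ j → twistPoly F j ≡ constPoly k j) → ∀ A → width (twist F A) ≡ 0
  to (k , const) A with width (twist F A) in w≡
  ... | zero  = refl
  ... | suc j = contradiction (sym (const (suc j)))
                  (<⇒≢ (filter-some (widthOf? (suc j)) (lose (∈-allSubsets A) w≡)))
  from : (∀ A → width (twist F A) ≡ 0) → ∃ λ k → ∀ j → twistPoly F j ≡ constPoly k j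
  from narrow = length (allSubsets n) , λ where
    zero    → cong length (filter-all (widthOf? 0) {allSubsets n} (tabulate λ {A} _ → narrow A))
    (suc j) → cong length (filter-none (widthOf? (suc j)) {allSubsets n}
                (tabulate λ {A} _ w≡ → 0≢1+n (trans (sym (narrow A)) w≡)))

twists-narrow⇔card≡1 : (F : Family n) → (∃ λ X → F X ≡ true) →
                       (∀ A → width (twist F A) ≡ 0) ⇔ card F ≡ 1
twists-narrow⇔card≡1 F (X₀ , FX₀) = mk⇔ to from
  where
  to : (∀ A → width (twist F A) ≡ 0) → card F ≡ 1
  to narrow = Equivalence.from (card≡1⇔singleton F) (X₀ , FX₀ , only)
    where
    only : ∀ {Y} → F Y ≡ true → Y ≡ X₀
    only {Y} FY = sym (∣Δ∣≡0⇒≡ X₀ Y (n≤0⇒n≡0 ∣X₀ΔY∣≤0))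
      where
      ∣X₀ΔY∣≤0 : ∣ X₀ Δ Y ∣ ≤ 0
      ∣X₀ΔY∣≤0 = subst (∣ X₀ Δ Y ∣ ≤_) (narrow X₀) (∣Δ∣≤width-twist F FX₀ FY)
  from : card F ≡ 1 → ∀ A → width (twist F A) ≡ 0
  from card≡1 A with Equivalence.to (card≡1⇔singleton F) card≡1
  ... | _ , singleton = width-singleton (twist F A) (twist-singleton F A singleton)

theorem3 : ∀ {n} (F : Family n) → IsDeltaMatroid F →
    ((∃ λ k → ∀ j → twistPoly F j ≡ constPoly k j) ⇔ (card F ≡ 1))
theorem3 F D =
  ⇔.trans (constant-twistPoly⇔twists-narrow F) (twists-narrow⇔card≡1 F (IsDeltaMatroid.nonempty D))
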